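{- For any graph $G$, $i_{dR}(G)\le 2\, i_{r2}(G)$, and this bound is sharp.
   Context: An independent double Roman dominating function (IDRDF) on a graph $G=(V,E)$ is a function $f:V\to\{0,1,2,3\}$ such that: every vertex $v$ with $f(v)=0$ has at least two neighbors $w$ with $f(w)=2$ or at least one neighbor $w$ with $f(w)=3$; every vertex $v$ with $f(v)=1$ has a neighbor $w$ with $f(w)\ge 2$; and $\{v: f(v)>0\}$ is independent. $i_{dR}(G)$ is the minimum weight $\sum_v f(v)$ of an IDRDF on $G$. A $2$-rainbow dominating function is a function $h:V\to\mathcal{P}(\{1,2\})$ such that every $v$ with $h(v)=\emptyset$ satisfies $\bigcup_{u\in N(v)}h(u)=\{1,2\}$; it is independent if no two vertices with $h(v)\neq\emptyset$ are adjacent. Its weight is $\sum_{v}|h(v)|$, and $i_{r2}(G)$ is the minimum weight of an independent $2$-rainbow dominating function on $G$. -}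

module Defs where

open import Data.Nat using (ℕ; zero; suc; _+_; _*_; _≤_)
open import Data.Fin using (Fin)
open import Data.Bool using (Bool; true; false)
open import Data.List using (tabulate)
open import Data.Nat.ListAction using (sum)
open import Data.Product using (Σ; ∃; ∃-syntax; _×_; _,_; proj₁; proj₂)
open import Data.Sum using (_⊎_)
open import Relation.Binary.PropositionalEquality using (_≡_; _≢_)
open import Relation.Nullary using (¬_)

record Graph : Set₁ where
  field
    n      : ℕ
    Adj    : Fin n → Fin n → Set
    sym    : ∀ {u v} → Adj u v → Adj v u
    irrefl : ∀ {v} → ¬ Adj v v
open Graph public

weight : ∀ {n} → (Fin n → ℕ) → ℕ
weight {n} f = sum (tabulate f)

IsIDRDF : (G : Graph) → (Fin (n G) → ℕ) → Set
IsIDRDF G f =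
    (∀ v → f v ≤ 3)
  × (∀ v → f v ≡ 0 →
        (∃[ w ] (Adj G v w × f w ≡ 3))
      ⊎ (∃[ w₁ ] ∃[ w₂ ] (w₁ ≢ w₂ × Adj G v w₁ × Adj G v w₂ × f w₁ ≡ 2 × f w₂ ≡ 2)))
  × (∀ v → f v ≡ 1 → ∃[ w ] (Adj G v w × 2 ≤ f w))
  × (∀ u v → Adj G u v → f u ≡ 0 ⊎ f v ≡ 0)

-- Independent 2-rainbow dominating functions
-- A subset of {1,2} is encoded as a pair of Booleans (1 ∈ S , 2 ∈ S).

Sub12 : Set
Sub12 = Bool × Bool

card : Sub12 → ℕ
card (a , b) = c a + c b
  where
  c : Bool → ℕ
  c true  = 1
  c false = 0

IsEmpty : Sub12 → Set
IsEmpty s = s ≡ (false , false)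

IsIR2DF : (G : Graph) → (Fin (n G) → Sub12) → Set
IsIR2DF G h =
    (∀ v → IsEmpty (h v) →
        (∃[ u ] (Adj G v u × proj₁ (h u) ≡ true))
      × (∃[ u ] (Adj G v u × proj₂ (h u) ≡ true)))
  × (∀ u v → Adj G u v → IsEmpty (h u) ⊎ IsEmpty (h v))

weightR : ∀ {n} → (Fin n → Sub12) → ℕ
weightR h = weight (λ v → card (h v))

IsIdR : Graph → ℕ → Set
IsIdR G k =
    (∃[ f ] (IsIDRDF G f × weight f ≡ k))
  × (∀ f → IsIDRDF G f → k ≤ weight f)

IsIr2 : Graph → ℕ → Set
IsIr2 G k =
    (∃[ h ] (IsIR2DF G h × weightR h ≡ k))
  × (∀ h → IsIR2DF G h → k ≤ weightR h)

module Submission where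

-- Turn an independent 2-rainbow dominating function h into a
-- double Roman labelling by sending ∅ ↦ 0, a singleton ↦ 2 and {1,2} ↦ 3.
-- Each vertex value at most doubles, so the weight at most doubles; the
-- label-0 vertices are exactly the rainbow-empty ones, so independence is
-- inherited; and an empty vertex sees colour 1 at some neighbour and colour 2
-- at some neighbour, which yields either a neighbour labelled 3 or two
-- distinct neighbours labelled 2.  Minimality of i_dR then gives the bound.
--
-- In any IDRDF an isolated vertex must get label ≥ 2, and in any
-- independent 2-rainbow dominating function it must get a nonempty set.  On
-- the edgeless graph with k vertices this gives i_dR = 2k and i_r2 = k.

open import Defs
open import Data.Nat using (ℕ; zero; suc; _+_; _*_; _≤_; _≥_; z≤n; s≤s)
open import Data.Nat.Properties
  using (+-mono-≤; ≤-refl; *-distribˡ-+; *-zeroʳ; *-identityˡ; *-suc; module ≤-Reasoning)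
open import Data.Product using (_×_; ∃-syntax; _,_; proj₁; proj₂)
open import Data.Sum using (_⊎_; inj₁; inj₂)
open import Data.Bool using (true; false)
open import Data.Fin using (Fin)
open import Data.Empty using (⊥; ⊥-elim)
open import Function using (_∘_)
open import Relation.Nullary using (¬_)
open import Relation.Binary.PropositionalEquality
  using (_≡_; _≢_; refl; cong; trans; module ≡-Reasoning)
  renaming (sym to ≡-sym)

weight-mono : ∀ {n} (f g : Fin n → ℕ) → (∀ i → f i ≤ g i) → weight f ≤ weight g
weight-mono {zero}  f g f≤g = z≤n
weight-mono {suc n} f g f≤g =
  +-mono-≤ (f≤g Fin.zero) (weight-mono (f ∘ Fin.suc) (g ∘ Fin.suc) (f≤g ∘ Fin.suc))

weight-scale : ∀ {n} (c : ℕ) (g : Fin n → ℕ) → weight (λ v → c * g v) ≡ c * weight g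
weight-scale {zero}  c g = ≡-sym (*-zeroʳ c)
weight-scale {suc n} c g = begin
  c * g Fin.zero + weight (λ i → c * g (Fin.suc i)) ≡⟨ cong (c * g Fin.zero +_) (weight-scale c (g ∘ Fin.suc)) ⟩
  c * g Fin.zero + c * weight (g ∘ Fin.suc)          ≡⟨ ≡-sym (*-distribˡ-+ c (g Fin.zero) _) ⟩
  c * weight g                                       ∎
  where open ≡-Reasoning

weight-const : ∀ n (c : ℕ) → weight {n} (λ _ → c) ≡ c * n
weight-const zero    c = ≡-sym (*-zeroʳ c)
weight-const (suc n) c = begin
  c + weight {n} (λ _ → c) ≡⟨ cong (c +_) (weight-const n c) ⟩
  c + c * n                ≡⟨ ≡-sym (*-suc c n) ⟩
  c * suc n                ∎
  where open ≡-Reasoning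

doubleRoman : Sub12 → ℕ
doubleRoman (true  , true)  = 3
doubleRoman (true  , false) = 2
doubleRoman (false , true)  = 2
doubleRoman (false , false) = 0

doubleRoman-≤3 : ∀ s → doubleRoman s ≤ 3
doubleRoman-≤3 (true  , true)  = ≤-refl
doubleRoman-≤3 (true  , false) = s≤s (s≤s z≤n)
doubleRoman-≤3 (false , true)  = s≤s (s≤s z≤n)
doubleRoman-≤3 (false , false) = z≤n

doubleRoman-≤-2card : ∀ s → doubleRoman s ≤ 2 * card s
doubleRoman-≤-2card (true  , true)  = s≤s (s≤s (s≤s z≤n))
doubleRoman-≤-2card (true  , false) = ≤-refl
doubleRoman-≤-2card (false , true)  = ≤-refl
doubleRoman-≤-2card (false , false) = z≤n

doubleRoman-zero⇒empty : ∀ s → doubleRoman s ≡ 0 → IsEmpty s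
doubleRoman-zero⇒empty (true  , true)  ()
doubleRoman-zero⇒empty (true  , false) ()
doubleRoman-zero⇒empty (false , true)  ()
doubleRoman-zero⇒empty (false , false) _ = refl

doubleRoman-empty⇒zero : ∀ s → IsEmpty s → doubleRoman s ≡ 0
doubleRoman-empty⇒zero _ refl = refl

doubleRoman≢1 : ∀ s → doubleRoman s ≢ 1
doubleRoman≢1 (true  , true)  ()
doubleRoman≢1 (true  , false) ()
doubleRoman≢1 (false , true)  ()
doubleRoman≢1 (false , false) ()

-- A set containing colour 1 and a set containing colour 2 carry either a
-- label 3, or two labels 2 on sets that differ (so on distinct vertices).
rainbow-pair : ∀ s₁ s₂ → proj₁ s₁ ≡ true → proj₂ s₂ ≡ true →
  doubleRoman s₁ ≡ 3 ⊎ doubleRoman s₂ ≡ 3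
  ⊎ (s₁ ≢ s₂ × doubleRoman s₁ ≡ 2 × doubleRoman s₂ ≡ 2)
rainbow-pair (true , true)  s₂              _ _ = inj₁ refl
rainbow-pair (true , false) (true , true)   _ _ = inj₂ (inj₁ refl)
rainbow-pair (true , false) (false , true)  _ _ = inj₂ (inj₂ ((λ ()) , refl , refl))

rainbow⇒doubleRoman : (G : Graph) (h : Fin (n G) → Sub12) →
  IsIR2DF G h → IsIDRDF G (doubleRoman ∘ h)
rainbow⇒doubleRoman G h (dominated , independent) =
  (doubleRoman-≤3 ∘ h) , zero-dominated , (λ v eq → ⊥-elim (doubleRoman≢1 (h v) eq)) , zero-independent
  where
  zero-dominated : ∀ v → doubleRoman (h v) ≡ 0 →
      (∃[ w ] (Adj G v w × doubleRoman (h w) ≡ 3))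
    ⊎ (∃[ w₁ ] ∃[ w₂ ] (w₁ ≢ w₂ × Adj G v w₁ × Adj G v w₂
                         × doubleRoman (h w₁) ≡ 2 × doubleRoman (h w₂) ≡ 2))
  zero-dominated v eq with dominated v (doubleRoman-zero⇒empty (h v) eq)
  ... | (u₁ , adj₁ , has1) , (u₂ , adj₂ , has2) with rainbow-pair (h u₁) (h u₂) has1 has2
  ... | inj₁ three              = inj₁ (u₁ , adj₁ , three)
  ... | inj₂ (inj₁ three)       = inj₁ (u₂ , adj₂ , three)
  ... | inj₂ (inj₂ (≢ , two₁ , two₂)) = inj₂ (u₁ , u₂ , (≢ ∘ cong h) , adj₁ , adj₂ , two₁ , two₂)

  zero-independent : ∀ u v → Adj G u v → doubleRoman (h u) ≡ 0 ⊎ doubleRoman (h v) ≡ 0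
  zero-independent u v adj with independent u v adj
  ... | inj₁ empty = inj₁ (doubleRoman-empty⇒zero (h u) empty)
  ... | inj₂ empty = inj₂ (doubleRoman-empty⇒zero (h v) empty)

idR≤2ir2 : ∀ (G : Graph) (a b : ℕ) → IsIdR G a → IsIr2 G b → a ≤ 2 * b
idR≤2ir2 G a b (_ , a-minimal) ((h , h-rainbow , refl) , _) = begin
  a                                ≤⟨ a-minimal _ (rainbow⇒doubleRoman G h h-rainbow) ⟩
  weight (doubleRoman ∘ h)         ≤⟨ weight-mono _ _ (doubleRoman-≤-2card ∘ h) ⟩
  weight (λ v → 2 * card (h v))    ≡⟨ weight-scale 2 (card ∘ h) ⟩
  2 * weightR h                    ∎
  where open ≤-Reasoning

Isolated : (G : Graph) → Fin (n G) → Set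
Isolated G v = ∀ w → ¬ Adj G v w

-- An IDRDF must give an isolated vertex label at least 2: labels 0 and 1
-- would both require a neighbour.
isolated-label≥2 : (G : Graph) (f : Fin (n G) → ℕ) → IsIDRDF G f →
  ∀ v → Isolated G v → 2 ≤ f v
isolated-label≥2 G f (_ , zero-dom , one-dom , _) v isolated with f v in eq
... | zero with zero-dom v eq
...   | inj₁ (w , adj , _)             = ⊥-elim (isolated w adj)
...   | inj₂ (w , _ , _ , adj , _)     = ⊥-elim (isolated w adj)
isolated-label≥2 G f (_ , _ , one-dom , _) v isolated | suc zero with one-dom v eq
...   | (w , adj , _) = ⊥-elim (isolated w adj)
isolated-label≥2 G f _ v _ | suc (suc m) = s≤s (s≤s z≤n)

-- An independent 2-rainbow dominating function must give an isolated vertex a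
-- nonempty set: an empty set would need a neighbour carrying colour 1.
isolated-card≥1 : (G : Graph) (h : Fin (n G) → Sub12) → IsIR2DF G h →
  ∀ v → Isolated G v → 1 ≤ card (h v)
isolated-card≥1 G h (dominated , _) v isolated with h v in eq
... | (true  , _)    = s≤s z≤n
... | (false , true) = s≤s z≤n
... | (false , false) with proj₁ (dominated v eq)
...   | (w , adj , _) = ⊥-elim (isolated w adj)

edgeless : ℕ → Graph
edgeless k = record { n = k ; Adj = λ _ _ → ⊥ ; sym = λ () ; irrefl = λ () }

edgeless-idR : ∀ k → IsIdR (edgeless k) (2 * k)
edgeless-idR k =
  ((λ _ → 2) , ((λ _ → s≤s (s≤s z≤n)) , (λ _ ()) , (λ _ ()) , (λ _ _ ())) , weight-const k 2)
  , λ f f-idrdf → begin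
      2 * k                    ≡⟨ ≡-sym (weight-const k 2) ⟩
      weight {k} (λ _ → 2)     ≤⟨ weight-mono _ f (λ v → isolated-label≥2 (edgeless k) f f-idrdf v (λ _ ())) ⟩
      weight f                 ∎
  where open ≤-Reasoning

edgeless-ir2 : ∀ k → IsIr2 (edgeless k) k
edgeless-ir2 k =
  ((λ _ → true , false) , ((λ _ ()) , (λ _ _ ())) , singleton-weight)
  , λ h h-rainbow → begin
      k                        ≡⟨ ≡-sym singleton-weight ⟩
      weight {k} (λ _ → 1)     ≤⟨ weight-mono _ _ (λ v → isolated-card≥1 (edgeless k) h h-rainbow v (λ _ ())) ⟩
      weightR h                ∎
  where
  open ≤-Reasoning
  singleton-weight : weight {k} (λ _ → 1) ≡ k
  singleton-weight = trans (weight-const k 1) (*-identityˡ k)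

proposition7 : (∀ (G : Graph) (a b : ℕ) → IsIdR G a → IsIr2 G b → a ≤ 2 * b)
    × (∀ (k : ℕ) → k ≥ 1 → ∃[ G ] (IsIdR G (2 * k) × IsIr2 G k))
proposition7 = idR≤2ir2 , λ k _ → edgeless k , edgeless-idR k , edgeless-ir2 k
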